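{- For positive integers $a,b$ define $(g_{a,b}(n))_{n\in\mathbb{N}}$ by $g_{a,b}(n)=0$ for integers $n<0$, $g_{a,b}(0)=a$, $g_{a,b}(1)=b$, and $g_{a,b}(n)=g_{a,b}(n-g_{a,b}(n-1))+g_{a,b}(n-2)$ for $n>1$. Then for all $n\in\mathbb{N}$: $$g_{1,1}(2n+6)=g_{1,1}(2n+4)+g_{1,1}(2n+2),\qquad g_{1,1}(2n+7)=4;$$ $$g_{1,2}(2n+6)=4,\qquad g_{1,2}(2n+5)=g_{1,2}(2n+3)+g_{1,2}(2n+1);$$ $$g_{2,1}(2n+8)=g_{2,1}(2n+6)+g_{2,1}(2n+2),\qquad g_{2,1}(2n+7)=6.$$ -}

module Defs where

open import Data.Nat using (ℕ; zero; suc; _∸_; _+_; _≤ᵇ_)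
open import Data.List using (List; []; _∷_; _++_; [_])
open import Data.Bool using (if_then_else_)

at : List ℕ → ℕ → ℕ
at []       _       = 0
at (x ∷ xs) zero    = x
at (x ∷ xs) (suc i) = at xs i

-- hist a b n = [ g_{a,b}(0) , … , g_{a,b}(n) ]  (course-of-values table).
-- Step for k = m + 2:  g(k) = g(k - g(k-1)) + g(k-2),
-- where g(j) = 0 for j < 0 (i.e. when g(k-1) > k).
-- (The out-of-range read when g(k-1) = 0 never happens for positive a, b,
--  since all values are then positive.)
hist : ℕ → ℕ → ℕ → List ℕ
hist a b zero          = [ a ]
hist a b (suc zero)    = a ∷ b ∷ []
hist a b (suc (suc m)) =
  let h  = hist a b (suc m)
      k  = suc (suc m)
      p  = at h (suc m)
      q  = at h m
      r  = if p ≤ᵇ k then at h (k ∸ p) else 0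
  in h ++ [ r + q ]

g : ℕ → ℕ → ℕ → ℕ
g a b n = at (hist a b n) n

-- Once g(k+1) = c and g(k+2) > k+3, the next term g(k+3) = g(k+3-g(k+2)) + g(k+1) reads
-- a negative index, so g(k+3) = c again; then g(k+4) = g(k+4-c) + g(k+2) exceeds k+5 as well,
-- because g(k+4-c) ≥ 2 is inherited along g(n) ≤ g(n+2). So from some index on, every other
-- term is frozen at c while the remaining ones satisfy a lagged Fibonacci recurrence; for
-- g_{1,1}, g_{1,2} and g_{2,1} this regime is entered at indices checked by computation.
module Submission where

open import Defs
open import Data.Nat using (ℕ; zero; suc; _+_; _*_; _∸_; _≤_; _<_; _≤ᵇ_; _≤?_; s≤s; z≤n)
open import Data.Nat.Properties
open import Data.List using (List; []; _∷_; _++_; [_]; length)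
open import Data.List.Properties using (length-++)
open import Data.Product using (_×_; _,_)
open import Data.Sum using (inj₁; inj₂)
open import Data.Bool using (if_then_else_)
open import Relation.Nullary.Decidable using (dec-true; dec-false)
open import Relation.Binary.PropositionalEquality
  using (_≡_; refl; sym; trans; cong; cong₂; subst; subst₂; module ≡-Reasoning)

at-++ˡ : ∀ (xs ys : List ℕ) {i} → i < length xs → at (xs ++ ys) i ≡ at xs i
at-++ˡ (x ∷ xs) ys {zero}  _         = refl
at-++ˡ (x ∷ xs) ys {suc i} (s≤s i<n) = at-++ˡ xs ys i<n

at-++-length : ∀ (xs : List ℕ) y → at (xs ++ [ y ]) (length xs) ≡ y
at-++-length []       y = refl
at-++-length (x ∷ xs) y = at-++-length xs y

length-hist : ∀ a b n → length (hist a b n) ≡ suc n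
length-hist a b zero          = refl
length-hist a b (suc zero)    = refl
length-hist a b (suc (suc m)) = begin
  length (hist a b (suc m) ++ _) ≡⟨ length-++ (hist a b (suc m)) ⟩
  length (hist a b (suc m)) + 1  ≡⟨ cong (_+ 1) (length-hist a b (suc m)) ⟩
  suc (suc m) + 1                ≡⟨ +-comm (suc (suc m)) 1 ⟩
  suc (suc (suc m))              ∎
  where open ≡-Reasoning

at-hist-suc : ∀ a b {n i} → i ≤ n → at (hist a b (suc n)) i ≡ at (hist a b n) i
at-hist-suc a b {zero}  z≤n = refl
at-hist-suc a b {suc m} i≤n =
  at-++ˡ (hist a b (suc m)) _ (subst (_ <_) (sym (length-hist a b (suc m))) (s≤s i≤n))

at-hist : ∀ a b {n i} → i ≤ n → at (hist a b n) i ≡ g a b i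
at-hist a b i≤n with m≤n⇒m<n∨m≡n i≤n
... | inj₂ refl = refl
at-hist a b {suc n} _ | inj₁ (s≤s i≤n) = trans (at-hist-suc a b i≤n) (at-hist a b i≤n)

lookback : List ℕ → ℕ → ℕ → ℕ
lookback h k p = if p ≤ᵇ k then at h (k ∸ p) else 0

lookback-≤ : ∀ h {k p} → p ≤ k → lookback h k p ≡ at h (k ∸ p)
lookback-≤ h {k} {p} p≤k = cong (λ t → if t then at h (k ∸ p) else 0) (dec-true (p ≤? k) p≤k)

lookback-> : ∀ h {k p} → k < p → lookback h k p ≡ 0
lookback-> h {k} {p} k<p = cong (λ t → if t then at h (k ∸ p) else 0) (dec-false (p ≤? k) (<⇒≱ k<p))

g-unfold : ∀ a b m →
  g a b (suc (suc m)) ≡ lookback (hist a b (suc m)) (suc (suc m)) (g a b (suc m)) + g a b m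
g-unfold a b m = begin
  at (hist a b (suc (suc m))) (suc (suc m))  ≡⟨ at-last ⟩
  step (at h (suc m)) (at h m)               ≡⟨ cong₂ step (at-hist a b {suc m} ≤-refl) (at-hist a b (n≤1+n m)) ⟩
  step (g a b (suc m)) (g a b m)             ∎
  where
  open ≡-Reasoning
  h : List ℕ
  h = hist a b (suc m)
  step : ℕ → ℕ → ℕ
  step p q = lookback h (suc (suc m)) p + q
  new : ℕ
  new = step (at h (suc m)) (at h m)
  at-last : at (h ++ [ new ]) (suc (suc m)) ≡ new
  at-last = subst (λ i → at (h ++ [ new ]) i ≡ new) (length-hist a b (suc m)) (at-++-length h new)

g-recurrence : ∀ {a b m d i} → g a b (suc m) ≡ suc d → i + suc d ≡ suc (suc m) →
  g a b (suc (suc m)) ≡ g a b i + g a b m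
g-recurrence {a} {b} {m} {d} {i} value lag = begin
  g a b (suc (suc m))                           ≡⟨ g-unfold a b m ⟩
  lookback h (suc (suc m)) (g a b (suc m)) + _  ≡⟨ cong (λ p → lookback h (suc (suc m)) p + g a b m) value ⟩
  lookback h (suc (suc m)) (suc d) + g a b m    ≡⟨ cong (_+ g a b m) (lookback-≤ h (subst (suc d ≤_) lag (m≤n+m (suc d) i))) ⟩
  at h (suc (suc m) ∸ suc d) + g a b m          ≡⟨ cong (λ j → at h j + g a b m) back ⟩
  at h i + g a b m                              ≡⟨ cong (_+ g a b m) (at-hist a b i≤1+m) ⟩
  g a b i + g a b m                             ∎
  where
  open ≡-Reasoning
  h : List ℕ
  h = hist a b (suc m)
  back : suc (suc m) ∸ suc d ≡ i
  back = trans (cong (_∸ suc d) (sym lag)) (m+n∸n≡m i (suc d))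
  i≤1+m : i ≤ suc m
  i≤1+m = subst (i ≤_) (suc-injective (trans (sym (+-suc i d)) lag)) (m≤m+n i d)

g-recurrence-beyond : ∀ {a b m} → suc (suc m) < g a b (suc m) → g a b (suc (suc m)) ≡ g a b m
g-recurrence-beyond {a} {b} {m} beyond =
  trans (g-unfold a b m) (cong (_+ g a b m) (lookback-> (hist a b (suc m)) beyond))

g≤g-2+ : ∀ a b m → g a b m ≤ g a b (suc (suc m))
g≤g-2+ a b m = subst (g a b m ≤_) (sym (g-unfold a b m)) (m≤n+m (g a b m) _)

2*n+2+m≡2+[2*n+m] : ∀ n m → 2 * n + suc (suc m) ≡ suc (suc (2 * n + m))
2*n+2+m≡2+[2*n+m] n m = trans (+-suc (2 * n) (suc m)) (cong suc (+-suc (2 * n) m))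

2*[1+n]+m≡2*n+[2+m] : ∀ n m → 2 * suc n + m ≡ 2 * n + suc (suc m)
2*[1+n]+m≡2*n+[2+m] n m = trans (cong (_+ m) (*-suc 2 n)) (sym (2*n+2+m≡2+[2*n+m] n m))

-- The regime at index k with frozen value d+1; r is the index read by the recurrence at k+2.
record Locked (a b d r k : ℕ) : Set where
  field
    lag    : r + suc d ≡ suc (suc k)
    value  : g a b (suc k) ≡ suc d
    beyond : 4 + k ≤ g a b (2 + k)
    side   : 2 ≤ g a b (2 + r)

module _ {a b d : ℕ} where

  locked-recurrence : ∀ {r k} → Locked a b d r k → g a b (2 + k) ≡ g a b r + g a b k
  locked-recurrence L = g-recurrence (Locked.value L) (Locked.lag L)

  locked-step : ∀ {r k} → Locked a b d r k → Locked a b d (2 + r) (2 + k)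
  locked-step {r} {k} L = record
    { lag    = cong (2 +_) lag
    ; value  = value′
    ; beyond = subst (6 + k ≤_) (sym recurrence′) (+-mono-≤ side beyond)
    ; side   = ≤-trans side (g≤g-2+ a b (2 + r))
    }
    where
    open Locked L
    value′ : g a b (3 + k) ≡ suc d
    value′ = trans (g-recurrence-beyond beyond) value
    recurrence′ : g a b (4 + k) ≡ g a b (2 + r) + g a b (2 + k)
    recurrence′ = g-recurrence {i = 2 + r} value′ (cong (2 +_) lag)

  locked-forever : ∀ {r k} → Locked a b d r k → ∀ n → Locked a b d (2 * n + r) (2 * n + k)
  locked-forever L zero    = L
  locked-forever {r} {k} L (suc n) =
    subst₂ (Locked a b d) (sym (2*[1+n]+m≡2*n+[2+m] n r)) (sym (2*[1+n]+m≡2*n+[2+m] n k))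
      (locked-forever (locked-step L) n)

  locked-value-forever : ∀ {r k} → Locked a b d r k → ∀ n → g a b (2 * n + suc k) ≡ suc d
  locked-value-forever {k = k} L n =
    trans (cong (g a b) (+-suc (2 * n) k)) (Locked.value (locked-forever L n))

  locked-recurrence-forever : ∀ {r k} → Locked a b d r k → ∀ n →
    g a b (2 * n + suc (suc k)) ≡ g a b (2 * n + r) + g a b (2 * n + k)
  locked-recurrence-forever {k = k} L n =
    trans (cong (g a b) (2*n+2+m≡2+[2*n+m] n k)) (locked-recurrence (locked-forever L n))

locked₁₁ : Locked 1 1 3 4 6
locked₁₁ = record { lag = refl ; value = refl ; beyond = ≤-refl ; side = s≤s (s≤s z≤n) }

locked₁₂ : Locked 1 2 3 3 5
locked₁₂ = record { lag = refl ; value = refl ; beyond = n≤1+n 9 ; side = s≤s (s≤s z≤n) }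

locked₂₁ : Locked 2 1 5 2 6
locked₂₁ = record { lag = refl ; value = refl ; beyond = ≤-refl ; side = s≤s (s≤s z≤n) }

g₁₁-even-recurrence : ∀ n → g 1 1 (2 * n + 6) ≡ g 1 1 (2 * n + 4) + g 1 1 (2 * n + 2)
g₁₁-even-recurrence zero = refl
g₁₁-even-recurrence (suc n)
  rewrite 2*[1+n]+m≡2*n+[2+m] n 6 | 2*[1+n]+m≡2*n+[2+m] n 4 | 2*[1+n]+m≡2*n+[2+m] n 2 =
  trans (locked-recurrence-forever locked₁₁ n) (+-comm (g 1 1 (2 * n + 4)) _)

g₁₂-odd-recurrence : ∀ n → g 1 2 (2 * n + 5) ≡ g 1 2 (2 * n + 3) + g 1 2 (2 * n + 1)
g₁₂-odd-recurrence zero = refl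
g₁₂-odd-recurrence (suc n)
  rewrite 2*[1+n]+m≡2*n+[2+m] n 5 | 2*[1+n]+m≡2*n+[2+m] n 3 | 2*[1+n]+m≡2*n+[2+m] n 1 =
  trans (locked-recurrence-forever locked₁₂ n) (+-comm (g 1 2 (2 * n + 3)) _)

theorem6p7 : (n : ℕ) →
      ((g 1 1 (2 * n + 6) ≡ g 1 1 (2 * n + 4) + g 1 1 (2 * n + 2)) × (g 1 1 (2 * n + 7) ≡ 4))
    × ((g 1 2 (2 * n + 6) ≡ 4) × (g 1 2 (2 * n + 5) ≡ g 1 2 (2 * n + 3) + g 1 2 (2 * n + 1)))
    × ((g 2 1 (2 * n + 8) ≡ g 2 1 (2 * n + 6) + g 2 1 (2 * n + 2)) × (g 2 1 (2 * n + 7) ≡ 6))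
theorem6p7 n =
    (g₁₁-even-recurrence n , locked-value-forever locked₁₁ n)
  , (locked-value-forever locked₁₂ n , g₁₂-odd-recurrence n)
  , ( trans (locked-recurrence-forever locked₂₁ n) (+-comm (g 2 1 (2 * n + 2)) _)
    , locked-value-forever locked₂₁ n)
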